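{- Let $p_1=w_1\kappa_1^-w_1'\kappa_1^+$ and $p_2=w_2\kappa_2^-w_2'$ be two paths based on a base of net $\beta$, where $\kappa_1^-,\kappa_2^-$ are negative actions and $\kappa_1^+$ is a positive action. The sequence $p=w_1\kappa_1^-w_1'\kappa_1^+\kappa_2^-w_2'$ is a path based on $\beta$ if the following conditions are satisfied: (a) $\kappa_1^+$ is a proper action; (b) $\ulcorner w_2\kappa_2^-\urcorner w_2'$ is a path based on $\beta$; (c) the actions of $\kappa_2^-w_2'$ and those of $w_1\kappa_1^-w_1'\kappa_1^+$ have distinct focuses; (d) either $\kappa_1^-$ and $\kappa_2^-$ are both initial, or they are justified by the same positive action, or $w_1=w_2=\kappa^+$ for a single positive action $\kappa^+$, $\kappa_1^-$ is justified by $\kappa^+$ and $\kappa_2^-$ is initial; (e) either $\ulcorner w_1\kappa_1^-\urcorner$ and $\ulcorner w_2\kappa_2^-\urcorner$ coincide except on their last actions, or they are respectively equal to $\kappa^+\kappa_1^-$ and $\kappa_2^-$.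
   Context: Ludics (Girard). Loci are finite sequences of naturals; $\xi.i$ extends $\xi$ by $i$. An action is a proper action $(\epsilon,\xi,I)$ (polarity $\epsilon\in\{+,-\}$, focus $\xi$, finite ramification $I$) or the positive daimon $\maltese$; $(\epsilon,\xi.i,J)$ is justified by $(\bar\epsilon,\xi,I)$ when $i\in I$. A base of net $\beta$ is a non-empty finite set of sequents $\Gamma_1\vdash\Delta_1,\dots,\Gamma_n\vdash\Delta_n$ of pairwise disjoint loci (none a prefix of another), each $\Gamma_i$ containing exactly one locus except at most one which is empty, each $\Delta_i$ finite; an action is initial if its focus is in some $\Gamma_i\cup\Delta_i$. Views: $\ulcorner\epsilon\urcorner=\epsilon$, $\ulcorner\kappa\urcorner=\kappa$, $\ulcorner w\kappa^+\urcorner=\ulcorner w\urcorner\kappa^+$, $\ulcorner w\kappa^-\urcorner=\ulcorner w_0\urcorner\kappa^-$ where $w_0$ is empty if $\kappa^-$ is initial and otherwise the prefix of $w$ ending with the positive action justifying $\kappa^-$. A path based on $\beta$ is a finite sequence $p$ of actions, each either a daimon or with focus hereditarily justified by an element of some $\Gamma_i\cup\Delta_i$, such that: polarities alternate; each proper action is justified by an earlier action of $p$ or initial, with focus in some $\Gamma_i$ if negative and in some $\Delta_i$ if positive; for every prefix $q\kappa$ of $p$, if $\kappa$ is a positive proper action justified by a negative action $\kappa'$ then $\kappa'$ occurs in $\ulcorner q\urcorner$, and if $\kappa$ is an initial positive proper action with focus in $\Delta_i$ then either $\kappa$ is the first action of $p$ and $\Gamma_i=\emptyset$, or $\kappa$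 is immediately preceded by a negative action whose focus is hereditarily justified by an element of $\Gamma_i\cup\Delta_i$; proper actions have distinct focuses; a daimon, if present, is last, and if it is the first action then some $\Gamma_i$ is empty; if some $\Gamma_i$ is empty then $p$ is non-empty and begins with $\maltese$ or with a positive action with focus in $\Delta_i$. -}

module Defs where

open import Data.Nat using (ℕ; _≟_)
open import Data.List using (List; []; _∷_; _++_; _∷ʳ_; [_]; reverse; mapMaybe)
open import Data.List.Properties using (≡-dec)
open import Data.List.Relation.Unary.Any using (Any; any?)
open import Data.List.Relation.Unary.All using (All)
open import Data.List.Relation.Unary.AllPairs using (AllPairs)
open import Data.List.Relation.Unary.Linked using (Linked)
open import Data.List.Relation.Unary.Unique.Propositional using (Unique)
open import Data.List.Membership.Propositional using (_∈_)
open import Data.Maybe using (Maybe; just; nothing; maybe)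
open import Data.Product using (Σ; ∃; ∃-syntax; _×_; _,_)
open import Data.Sum using (_⊎_)
open import Data.Unit using (⊤)
open import Data.Empty using (⊥)
open import Relation.Nullary using (¬_; Dec; yes; no)
open import Relation.Nullary.Decidable using (_×-dec_)
open import Relation.Binary.PropositionalEquality using (_≡_; _≢_)

-- A locus is a finite sequence of naturals; ξ.i is  ξ ∷ʳ i.
Locus : Set
Locus = List ℕ

-- ξ is a prefix of ζ (ζ is hereditarily justified by ξ as loci).
Prefix : Locus → Locus → Set
Prefix ξ ζ = ∃[ η ] (ξ ++ η ≡ ζ)

data Pol : Set where
  pos neg : Pol

_≟ᴾ_ : (a b : Pol) → Dec (a ≡ b)
pos ≟ᴾ pos = yes _≡_.refl
pos ≟ᴾ neg = no λ ()
neg ≟ᴾ pos = no λ ()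
neg ≟ᴾ neg = yes _≡_.refl

flip : Pol → Pol
flip pos = neg
flip neg = pos

-- An action: the daimon, or a proper action (ε, ξ, I) with finite
-- ramification I (a finite set of naturals, given as a list).
data Action : Set where
  ✠ : Action
  proper : (ε : Pol) (ξ : Locus) (I : List ℕ) → Action

pol : Action → Pol
pol ✠ = pos
pol (proper ε _ _) = ε

data IsProper : Action → Set where
  isProper : ∀ ε ξ I → IsProper (proper ε ξ I)

focus? : Action → Maybe Locus
focus? ✠ = nothing
focus? (proper _ ξ _) = just ξ

foci : List Action → List Locus
foci = mapMaybe focus?

Justifies : Action → Action → Set
Justifies ✠ _ = ⊥
Justifies (proper ε ξ I) ✠ = ⊥
Justifies (proper ε ξ I) (proper ε' ζ J) = (ε' ≡ flip ε) × Any (λ i → ζ ≡ ξ ∷ʳ i) I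

justifies? : (a b : Action) → Dec (Justifies a b)
justifies? ✠ _ = no λ ()
justifies? (proper ε ξ I) ✠ = no λ ()
justifies? (proper ε ξ I) (proper ε' ζ J) =
  (ε' ≟ᴾ flip ε) ×-dec any? (λ i → ≡-dec _≟_ ζ (ξ ∷ʳ i)) I

record Sequent : Set where
  constructor _⊢_
  field
    Γ : Maybe Locus
    Δ : List Locus
open Sequent public

locs : Sequent → List Locus
locs s = maybe [_] [] (Γ s) ++ Δ s

_∈Γ_ : Locus → Sequent → Set
ξ ∈Γ s = Γ s ≡ just ξ

BaseSeqs : Set
BaseSeqs = List Sequent

allLoci : BaseSeqs → List Locus
allLoci [] = []
allLoci (s ∷ β) = locs s ++ allLoci β

DisjointLoci : Locus → Locus → Set
DisjointLoci ξ ζ = ¬ Prefix ξ ζ × ¬ Prefix ζ ξ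

record Base (β : BaseSeqs) : Set where
  field
    nonEmpty : β ≢ []
    disjoint : AllPairs DisjointLoci (allLoci β)
    atMostOneEmptyΓ : AllPairs (λ s t → ¬ (Γ s ≡ nothing × Γ t ≡ nothing)) β

Initial : BaseSeqs → Action → Set
Initial β ✠ = ⊥
Initial β (proper _ ξ _) = Any (λ s → ξ ∈ locs s) β

initial? : (β : BaseSeqs) (a : Action) → Dec (Initial β a)
initial? β ✠ = no λ ()
initial? β (proper _ ξ _) =
  any? (λ s → Data.List.Membership.DecPropositional._∈?_ (≡-dec _≟_) ξ (locs s)) β
  where import Data.List.Membership.DecPropositional

-- Views.  Computed on the reversed sequence (most recent action first).

mutual
  viewR : BaseSeqs → List Action → List Action
  viewR β [] = []
  viewR β (✠ ∷ w) = ✠ ∷ viewR β w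
  viewR β (proper pos ξ I ∷ w) = proper pos ξ I ∷ viewR β w
  viewR β (proper neg ξ I ∷ w) with initial? β (proper neg ξ I)
  ... | yes _ = proper neg ξ I ∷ []
  ... | no _  = proper neg ξ I ∷ jump β (proper neg ξ I) w

  -- w₀ = the prefix of w ending with the (most recent) positive action
  -- justifying κ; (empty if there is none, a case which never occurs for
  -- prefixes of paths).
  jump : BaseSeqs → Action → List Action → List Action
  jump β κ [] = []
  jump β κ (a ∷ w) with justifies? a κ
  ... | yes _ = a ∷ viewR β w
  ... | no _  = jump β κ w

view : BaseSeqs → List Action → List Action
view β w = reverse (viewR β (reverse w))

HerJust : BaseSeqs → Action → Set
HerJust β ✠ = ⊤
HerJust β (proper _ ξ _) = Any (λ s → Any (λ l → Prefix l ξ) (locs s)) β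

Alternate : Action → Action → Set
Alternate a b = pol b ≡ flip (pol a)

JustCond : BaseSeqs → List Action → Action → Set
JustCond β q ✠ = ⊤
JustCond β q (proper neg ξ I) =
  Any (λ b → Justifies b (proper neg ξ I)) q ⊎ Any (λ s → ξ ∈Γ s) β
JustCond β q (proper pos ξ I) =
  Any (λ b → Justifies b (proper pos ξ I)) q ⊎ Any (λ s → ξ ∈ Δ s) β

record Path (β : BaseSeqs) (p : List Action) : Set where
  field
    herJust : All (HerJust β) p
    alternate : Linked Alternate p
    justified : ∀ q κ r → p ≡ q ++ κ ∷ r → JustCond β q κ
    viewCond : ∀ q κ r → p ≡ q ++ κ ∷ r → pol κ ≡ pos →
               ∀ κ' → κ' ∈ q → pol κ' ≡ neg → Justifies κ' κ → κ' ∈ view β q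
    initPos : ∀ q ξ I r → p ≡ q ++ proper pos ξ I ∷ r →
              ∀ s → s ∈ β → ξ ∈ Δ s →
              (q ≡ [] × Γ s ≡ nothing)
              ⊎ (∃[ q' ] ∃[ ξ' ] ∃[ I' ] (q ≡ q' ∷ʳ proper neg ξ' I'
                   × Any (λ l → Prefix l ξ') (locs s)))
    distinctFoci : Unique (foci p)
    daimonLast : ∀ q r → p ≡ q ++ ✠ ∷ r →
                 r ≡ [] × (q ≡ [] → Any (λ s → Γ s ≡ nothing) β)
    emptyΓ : ∀ s → s ∈ β → Γ s ≡ nothing →
             ∃[ a ] ∃[ r ] (p ≡ a ∷ r ×
               (a ≡ ✠ ⊎ ∃[ ξ ] ∃[ I ] (a ≡ proper pos ξ I × ξ ∈ Δ s)))

-- Write ⌜w₂κ₂⁻⌝ = u κ₂⁻.  By (e), u is empty or ⌜w₁κ₁⁻⌝ without its last action,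
-- so u is a subsequence of p₁ in which every positive action is followed by
-- the view of what precedes it in p₁.  The view of a prefix p₁κ₂⁻x of p is
-- computed backwards through x and κ₂⁻ and leaves them only by jumping to a
-- justifier: one lying in κ₂⁻w₂' has no counterpart in p₁ by (c), so the jump
-- is empty in both sequences; one lying in u is found at the same place in p₁,
-- because foci are unique, and the view continues identically there.  Hence
-- ⌜p₁κ₂⁻x⌝ = ⌜uκ₂⁻x⌝, and each clause of the definition of a path transfers to
-- p: for actions of p₁ from p₁, for the others from the path (b), using (c) for
-- distinct foci and (a) to keep the daimon out of p₁.
module Submission where

open import Defs
open import Data.Empty using (⊥; ⊥-elim)
open import Data.List using (List; []; _∷_; _++_; _∷ʳ_; [_]; reverse)
open import Data.List.Properties
  using (++-assoc; ∷-injective; ∷-injectiveʳ; ∷ʳ-injectiveˡ; ∷ʳ-injectiveʳ; ++-conicalʳ;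
         ++-identityʳ-unique; unfold-reverse; reverse-++; reverse-involutive; mapMaybe-++)
open import Data.List.Membership.Propositional using (_∈_; _∉_; find)
open import Data.List.Membership.Propositional.Properties using (∈-++⁺ˡ; ∈-++⁺ʳ; ∈-++⁻; ∈-∃++)
open import Data.List.Relation.Binary.Disjoint.Propositional using (Disjoint)
open import Data.List.Relation.Binary.Subset.Propositional using (_⊆_)
open import Data.List.Relation.Binary.Subset.Propositional.Properties as Subset using (∷⁺ʳ; Any-resp-⊆)
open import Data.List.Relation.Unary.All as All using (All; []; _∷_)
import Data.List.Relation.Unary.All.Properties as All
open import Data.List.Relation.Unary.AllPairs using (AllPairs; _∷_)
open import Data.List.Relation.Unary.Any as Any using (Any; here; there)
import Data.List.Relation.Unary.Any.Properties as Any
open import Data.List.Relation.Unary.Linked as Linked using (Linked; [-]; _∷_)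
open import Data.List.Relation.Unary.Unique.Propositional using (Unique)
import Data.List.Relation.Unary.Unique.Propositional.Properties as Unique
open import Data.Maybe using (just; nothing; maybe)
open import Data.Product using (∃-syntax; _×_; _,_)
open import Data.Sum using (_⊎_; inj₁; inj₂)
open import Data.Unit using (tt)
open import Function using (_∘_)
open import Relation.Binary.PropositionalEquality
  using (_≡_; _≢_; refl; sym; trans; cong; cong₂; subst; module ≡-Reasoning)
open import Relation.Nullary using (¬_; yes; no)

open ≡-Reasoning

module _ {A : Set} where

  ++-∷≢[] : ∀ (xs : List A) {y ys} → xs ++ y ∷ ys ≢ []
  ++-∷≢[] xs eq with ++-conicalʳ xs _ eq
  ... | ()

  reverse-++-∷ : ∀ (xs : List A) y ys → reverse (xs ++ y ∷ ys) ≡ reverse ys ++ y ∷ reverse xs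
  reverse-++-∷ xs y ys = begin
    reverse (xs ++ y ∷ ys)             ≡⟨ reverse-++ xs (y ∷ ys) ⟩
    reverse (y ∷ ys) ++ reverse xs     ≡⟨ cong (_++ reverse xs) (unfold-reverse y ys) ⟩
    (reverse ys ∷ʳ y) ++ reverse xs    ≡⟨ ++-assoc (reverse ys) [ y ] (reverse xs) ⟩
    reverse ys ++ y ∷ reverse xs       ∎

  ++-∷-cases : ∀ (xs ys q : List A) {z r} → xs ++ ys ≡ q ++ z ∷ r →
               (∃[ r' ] xs ≡ q ++ z ∷ r') ⊎ (∃[ x ] (q ≡ xs ++ x × ys ≡ x ++ z ∷ r))
  ++-∷-cases [] ys q eq = inj₂ (q , refl , eq)
  ++-∷-cases (x ∷ xs) ys [] eq with refl , _ ← ∷-injective eq = inj₁ (xs , refl)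
  ++-∷-cases (x ∷ xs) ys (_ ∷ q) eq with refl , eq' ← ∷-injective eq
                                      with ++-∷-cases xs ys q eq'
  ... | inj₁ (r' , xs≡) = inj₁ (r' , cong (x ∷_) xs≡)
  ... | inj₂ (v , q≡ , ys≡) = inj₂ (v , cong (x ∷_) q≡ , ys≡)

  prefix-⊆ : ∀ {xs ys zs : List A} → ys ≡ xs ++ zs → xs ⊆ ys
  prefix-⊆ ys≡ x∈ = subst (_ ∈_) (sym ys≡) (∈-++⁺ˡ x∈)

  ∷ʳ-++⁻ʳ : ∀ xs {ys q : List A} {z} → ys ≢ [] → xs ++ ys ≡ q ∷ʳ z → ∃[ q' ] ys ≡ q' ∷ʳ z
  ∷ʳ-++⁻ʳ [] _ eq = _ , eq
  ∷ʳ-++⁻ʳ (x ∷ xs) {q = []} ys≢[] eq = ⊥-elim (ys≢[] (++-conicalʳ xs _ (∷-injectiveʳ eq)))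
  ∷ʳ-++⁻ʳ (x ∷ xs) {q = _ ∷ q} ys≢[] eq = ∷ʳ-++⁻ʳ xs ys≢[] (∷-injectiveʳ eq)

  module _ {R : A → A → Set} where

    Linked-++⁻ʳ : ∀ xs {ys} → Linked R (xs ++ ys) → Linked R ys
    Linked-++⁻ʳ [] l = l
    Linked-++⁻ʳ (_ ∷ xs) l = Linked-++⁻ʳ xs (Linked.tail l)

    Linked-∷ʳ-++ : ∀ xs {x y ys} → Linked R (xs ∷ʳ x) → R x y → Linked R (y ∷ ys) →
                   Linked R ((xs ∷ʳ x) ++ y ∷ ys)
    Linked-∷ʳ-++ [] [-] r l = r ∷ l
    Linked-∷ʳ-++ (_ ∷ []) (r' ∷ [-]) r l = r' ∷ r ∷ l
    Linked-∷ʳ-++ (_ ∷ _ ∷ xs) (r' ∷ l') r l = r' ∷ Linked-∷ʳ-++ (_ ∷ xs) l' r l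

    AllPairs-++⁻ʳ : ∀ xs {ys} → AllPairs R (xs ++ ys) → AllPairs R ys
    AllPairs-++⁻ʳ [] p = p
    AllPairs-++⁻ʳ (_ ∷ xs) (_ ∷ p) = AllPairs-++⁻ʳ xs p

    AllPairs-∈ : ∀ {xs x y} → AllPairs R xs → x ∈ xs → y ∈ xs → x ≡ y ⊎ R x y ⊎ R y x
    AllPairs-∈ (_ ∷ _) (here refl) (here refl) = inj₁ refl
    AllPairs-∈ (h ∷ _) (here refl) (there y∈) = inj₂ (inj₁ (All.lookup h y∈))
    AllPairs-∈ (h ∷ _) (there x∈) (here refl) = inj₂ (inj₂ (All.lookup h x∈))
    AllPairs-∈ (_ ∷ p) (there x∈) (there y∈) = AllPairs-∈ p x∈ y∈

∈Γ⇒∈locs : ∀ {ξ} s → ξ ∈Γ s → ξ ∈ locs s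
∈Γ⇒∈locs (just _ ⊢ _) refl = here refl

∈Δ⇒∈locs : ∀ {ξ} s → ξ ∈ Δ s → ξ ∈ locs s
∈Δ⇒∈locs s = ∈-++⁺ʳ (maybe [_] [] (Γ s))

∈-allLoci : ∀ {β s l} → s ∈ β → l ∈ locs s → l ∈ allLoci β
∈-allLoci (here refl) l∈ = ∈-++⁺ˡ l∈
∈-allLoci {s' ∷ _} (there s∈) l∈ = ∈-++⁺ʳ (locs s') (∈-allLoci s∈ l∈)

base-extension-trivial : ∀ {β l η} → Base β → l ∈ allLoci β → l ++ η ∈ allLoci β → η ≡ []
base-extension-trivial base l∈ lη∈ with AllPairs-∈ (Base.disjoint base) l∈ lη∈
... | inj₁ l≡lη = ++-identityʳ-unique _ l≡lη
... | inj₂ (inj₁ (l⋢lη , _)) = ⊥-elim (l⋢lη (_ , refl))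
... | inj₂ (inj₂ (_ , l⋢lη)) = ⊥-elim (l⋢lη (_ , refl))

initial-positive-unjustified : ∀ {β b ξ I} → Base β → HerJust β b →
  Justifies b (proper pos ξ I) → Any (λ s → ξ ∈ Δ s) β → ⊥
initial-positive-unjustified {β} {b = proper _ _ _} base hj (_ , i∈I) ξ∈Δ
  with find hj | find i∈I | find ξ∈Δ
... | s , s∈ , base-prefix | i , _ , refl | s' , s'∈ , ξ∈ with find base-prefix
... | l , l∈ , η , refl =
  ++-∷≢[] η (base-extension-trivial base (∈-allLoci s∈ l∈)
    (subst (_∈ allLoci β) (++-assoc l η [ i ]) (∈-allLoci s'∈ (∈Δ⇒∈locs s' ξ∈))))

JustCond-mono : ∀ {β q q'} κ → q ⊆ q' → JustCond β q κ → JustCond β q' κ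
JustCond-mono ✠ _ _ = tt
JustCond-mono (proper neg _ _) q⊆q' (inj₁ j) = inj₁ (Any-resp-⊆ q⊆q' j)
JustCond-mono (proper neg _ _) _ (inj₂ i) = inj₂ i
JustCond-mono (proper pos _ _) q⊆q' (inj₁ j) = inj₁ (Any-resp-⊆ q⊆q' j)
JustCond-mono (proper pos _ _) _ (inj₂ i) = inj₂ i

foci-++ : ∀ xs ys → foci (xs ++ ys) ≡ foci xs ++ foci ys
foci-++ = mapMaybe-++ focus?

∈-foci : ∀ {x ξ} xs → x ∈ xs → focus? x ≡ just ξ → ξ ∈ foci xs
∈-foci (✠ ∷ _) (here refl) ()
∈-foci (proper _ _ _ ∷ _) (here refl) refl = here refl
∈-foci (✠ ∷ xs) (there x∈) fx = ∈-foci xs x∈ fx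
∈-foci (proper _ _ _ ∷ xs) (there x∈) fx = there (∈-foci xs x∈ fx)

Unique-foci-++⁻ʳ : ∀ xs {ys} → Unique (foci (xs ++ ys)) → Unique (foci ys)
Unique-foci-++⁻ʳ xs {ys} u = AllPairs-++⁻ʳ (foci xs) (subst Unique (foci-++ xs ys) u)

focus-∉-foci-tail : ∀ {x ξ} xs → Unique (foci (x ∷ xs)) → focus? x ≡ just ξ → ξ ∉ foci xs
focus-∉-foci-tail {proper _ _ _} xs (fresh ∷ _) refl ξ∈ = All.lookup fresh ξ∈ refl

same-focus⇒≡ : ∀ {a b ξ} L → Unique (foci L) → a ∈ L → b ∈ L →
               focus? a ≡ just ξ → focus? b ≡ just ξ → a ≡ b
same-focus⇒≡ _ _ (here refl) (here refl) _ _ = refl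
same-focus⇒≡ (_ ∷ L) u (here refl) (there b∈) fa fb = ⊥-elim (focus-∉-foci-tail L u fa (∈-foci L b∈ fb))
same-focus⇒≡ (_ ∷ L) u (there a∈) (here refl) fa fb = ⊥-elim (focus-∉-foci-tail L u fb (∈-foci L a∈ fa))
same-focus⇒≡ (x ∷ L) u (there a∈) (there b∈) fa fb = same-focus⇒≡ L (Unique-foci-++⁻ʳ [ x ] {L} u) a∈ b∈ fa fb

cojustifiers-focus : ∀ {a b c} → Justifies b a → Justifies c a →
                     ∃[ ζ ] (focus? b ≡ just ζ × focus? c ≡ just ζ)
cojustifiers-focus {✠} {proper _ _ _} ()
cojustifiers-focus {proper _ _ _} {proper _ _ _} {✠} _ ()
cojustifiers-focus {proper _ _ _} {proper _ ζ _} {proper _ ζ' _} (_ , i∈) (_ , j∈)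
  with find i∈ | find j∈
... | _ , _ , ξ≡ζi | _ , _ , ξ≡ζ'j = ζ , refl , cong just (∷ʳ-injectiveˡ ζ' ζ (trans (sym ξ≡ζ'j) ξ≡ζi))

cojustifiers-≡ : ∀ {a b c} L → Unique (foci L) → b ∈ L → c ∈ L →
                 Justifies b a → Justifies c a → b ≡ c
cojustifiers-≡ L u b∈ c∈ jb jc with cojustifiers-focus jb jc
... | _ , fb , fc = same-focus⇒≡ L u b∈ c∈ fb fc

cojustifiers-apart : ∀ {a b c L L'} → Disjoint (foci L) (foci L') → b ∈ L → c ∈ L' →
                     Justifies b a → Justifies c a → ⊥
cojustifiers-apart {L = L} {L'} apart b∈ c∈ jb jc with cojustifiers-focus jb jc
... | _ , fb , fc = apart (∈-foci L b∈ fb , ∈-foci L' c∈ fc)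

cojustifier-not-after : ∀ {a c x} X {Y} → Unique (foci (X ++ c ∷ Y)) → x ∈ Y →
                        Justifies c a → Justifies x a → ⊥
cojustifier-not-after X {Y} u x∈ jc jx with cojustifiers-focus jc jx
... | _ , fc , fx = focus-∉-foci-tail Y (Unique-foci-++⁻ʳ X {_ ∷ Y} u) fc (∈-foci Y x∈ fx)

justifier-of-neg-is-pos : ∀ {a c} → pol a ≡ neg → Justifies c a → pol c ≡ pos
justifier-of-neg-is-pos {proper _ _ _} {proper pos _ _} _ _ = refl
justifier-of-neg-is-pos {proper .pos _ _} {proper neg _ _} () (refl , _)

neg-not-justifies-neg : ∀ {a c} → pol c ≡ neg → pol a ≡ neg → ¬ Justifies c a
neg-not-justifies-neg {proper neg _ _} {proper neg _ _} _ _ (() , _)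

module Views (β : BaseSeqs) where

  viewR-initial : ∀ {ξ I} L → Initial β (proper neg ξ I) → viewR β (proper neg ξ I ∷ L) ≡ proper neg ξ I ∷ []
  viewR-initial {ξ} {I} _ i with initial? β (proper neg ξ I)
  ... | yes _ = refl
  ... | no ni = ⊥-elim (ni i)

  viewR-nonInitial : ∀ {ξ I} L → ¬ Initial β (proper neg ξ I) →
                     viewR β (proper neg ξ I ∷ L) ≡ proper neg ξ I ∷ jump β (proper neg ξ I) L
  viewR-nonInitial {ξ} {I} _ ni with initial? β (proper neg ξ I)
  ... | yes i = ⊥-elim (ni i)
  ... | no _ = refl

  jump-++-∷ : ∀ κ C {c D} → Justifies c κ → (∀ {x} → x ∈ C → ¬ Justifies x κ) →
              jump β κ (C ++ c ∷ D) ≡ c ∷ viewR β D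
  jump-++-∷ κ [] {c} jc _ with justifies? c κ
  ... | yes _ = refl
  ... | no ¬jc = ⊥-elim (¬jc jc)
  jump-++-∷ κ (x ∷ C) jc none with justifies? x κ
  ... | yes jx = ⊥-elim (none (here refl) jx)
  ... | no _ = jump-++-∷ κ C jc (none ∘ there)

  jump-some : ∀ κ L {b} → b ∈ L → Justifies b κ →
              ∃[ A ] ∃[ c ] ∃[ B ] (L ≡ A ++ c ∷ B × Justifies c κ × jump β κ L ≡ c ∷ viewR β B)
  jump-some κ (a ∷ L) b∈ jb with justifies? a κ
  ... | yes ja = [] , a , L , refl , ja , refl
  jump-some κ (a ∷ L) (here refl) jb | no ¬ja = ⊥-elim (¬ja jb)
  jump-some κ (a ∷ L) (there b∈) jb | no _ with jump-some κ L b∈ jb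
  ... | A , c , B , refl , jc , jump≡ = a ∷ A , c , B , refl , jc , jump≡

  jump-none : ∀ κ L → (∀ {x} → x ∈ L → ¬ Justifies x κ) → jump β κ L ≡ []
  jump-none κ [] _ = refl
  jump-none κ (a ∷ L) none with justifies? a κ
  ... | yes ja = ⊥-elim (none (here refl) ja)
  ... | no _ = jump-none κ L (none ∘ there)

  mutual
    viewR-⊆ : ∀ L → viewR β L ⊆ L
    viewR-⊆ [] ()
    viewR-⊆ (✠ ∷ L) = ∷⁺ʳ ✠ (viewR-⊆ L)
    viewR-⊆ (proper pos ξ I ∷ L) = ∷⁺ʳ _ (viewR-⊆ L)
    viewR-⊆ (proper neg ξ I ∷ L) with initial? β (proper neg ξ I)
    ... | yes _ = ∷⁺ʳ _ λ ()
    ... | no _ = ∷⁺ʳ _ (jump-⊆ _ L)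

    jump-⊆ : ∀ κ L → jump β κ L ⊆ L
    jump-⊆ κ [] ()
    jump-⊆ κ (a ∷ L) with justifies? a κ
    ... | yes _ = ∷⁺ʳ a (viewR-⊆ L)
    ... | no _ = there ∘ jump-⊆ κ L

  mutual
    viewR-idem : ∀ L → viewR β (viewR β L) ≡ viewR β L
    viewR-idem [] = refl
    viewR-idem (✠ ∷ L) = cong (✠ ∷_) (viewR-idem L)
    viewR-idem (proper pos ξ I ∷ L) = cong (proper pos ξ I ∷_) (viewR-idem L)
    viewR-idem (proper neg ξ I ∷ L) with initial? β (proper neg ξ I)
    ... | yes i = viewR-initial [] i
    ... | no ni = trans (viewR-nonInitial _ ni) (cong (proper neg ξ I ∷_) (jump-idem _ L))

    jump-idem : ∀ κ L → jump β κ (jump β κ L) ≡ jump β κ L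
    jump-idem κ [] = refl
    jump-idem κ (a ∷ L) with justifies? a κ
    ... | yes ja = trans (jump-++-∷ κ [] ja (λ ())) (cong (a ∷_) (viewR-idem L))
    ... | no _ = jump-idem κ L

  -- Both sequences are reversed, as for viewR: behind each positive action c of
  -- V, V continues with the view of what precedes c in L.
  ViewClosed : List Action → List Action → Set
  ViewClosed L V = ∀ A c B → pol c ≡ pos → V ≡ A ++ c ∷ B →
                   ∃[ C ] ∃[ D ] (L ≡ C ++ c ∷ D × B ≡ viewR β D)

  ViewClosed-[] : ∀ {L} → ViewClosed L []
  ViewClosed-[] A _ _ _ eq = ⊥-elim (++-∷≢[] A (sym eq))

  ViewClosed-++ : ∀ X {L V} → ViewClosed L V → ViewClosed (X ++ L) V
  ViewClosed-++ X closed A c B c-pos eq with closed A c B c-pos eq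
  ... | C , D , refl , B≡ = X ++ C , D , sym (++-assoc X C _) , B≡

  ViewClosed-∷ : ∀ {a L V} → (pol a ≡ pos → V ≡ viewR β L) → ViewClosed L V → ViewClosed (a ∷ L) (a ∷ V)
  ViewClosed-∷ V≡ _ [] c B c-pos eq with refl , refl ← ∷-injective eq = [] , _ , refl , V≡ c-pos
  ViewClosed-∷ _ closed (_ ∷ A) c B c-pos eq with closed A c B c-pos (∷-injectiveʳ eq)
  ... | C , D , refl , B≡ = _ ∷ C , D , refl , B≡

  mutual
    viewR-closed : ∀ L → ViewClosed L (viewR β L)
    viewR-closed [] = ViewClosed-[]
    viewR-closed (✠ ∷ L) = ViewClosed-∷ (λ _ → refl) (viewR-closed L)
    viewR-closed (proper pos ξ I ∷ L) = ViewClosed-∷ (λ _ → refl) (viewR-closed L)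
    viewR-closed (proper neg ξ I ∷ L) with initial? β (proper neg ξ I)
    ... | yes _ = ViewClosed-∷ (λ ()) ViewClosed-[]
    ... | no _ = ViewClosed-∷ (λ ()) (jump-closed _ L)

    jump-closed : ∀ κ L → ViewClosed L (jump β κ L)
    jump-closed κ [] = ViewClosed-[]
    jump-closed κ (a ∷ L) with justifies? a κ
    ... | yes _ = ViewClosed-∷ (λ _ → refl) (viewR-closed L)
    ... | no _ = ViewClosed-++ [ a ] (jump-closed κ L)

  view-∷ʳ-neg : ∀ w {a} → pol a ≡ neg →
    ∃[ T ] (view β (w ∷ʳ a) ≡ reverse T ∷ʳ a × T ⊆ reverse w × ViewClosed (reverse w) T)
  view-∷ʳ-neg w {✠} ()
  view-∷ʳ-neg w {proper pos _ _} ()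
  view-∷ʳ-neg w {proper neg ξ I} _ rewrite reverse-++ w [ proper neg ξ I ]
    with initial? β (proper neg ξ I)
  ... | yes _ = [] , refl , (λ ()) , ViewClosed-[]
  ... | no _ = let T = jump β (proper neg ξ I) (reverse w) in
    T , unfold-reverse (proper neg ξ I) T , jump-⊆ _ (reverse w) , jump-closed _ (reverse w)

  module _ (Q U : List Action) where

    SameJumps : Action → Set
    SameJumps a = pol a ≡ neg → ¬ Initial β a → jump β a Q ≡ jump β a U

    -- Reading X k backwards, a negative k stops the view, which then enters
    -- the past only through the jumps of non-initial negative actions.
    mutual
      viewR-replace-past : ∀ X {k} → pol k ≡ neg → SameJumps k → All SameJumps X →
                           viewR β (X ++ k ∷ Q) ≡ viewR β (X ++ k ∷ U)
      viewR-replace-past [] {✠} ()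
      viewR-replace-past [] {proper pos _ _} ()
      viewR-replace-past [] {proper neg ξ I} _ same-k [] with initial? β (proper neg ξ I)
      ... | yes _ = refl
      ... | no ni = cong (proper neg ξ I ∷_) (same-k refl ni)
      viewR-replace-past (✠ ∷ X) k-neg same-k (_ ∷ same) =
        cong (✠ ∷_) (viewR-replace-past X k-neg same-k same)
      viewR-replace-past (proper pos ξ I ∷ X) k-neg same-k (_ ∷ same) =
        cong (proper pos ξ I ∷_) (viewR-replace-past X k-neg same-k same)
      viewR-replace-past (proper neg ξ I ∷ X) k-neg same-k (same-a ∷ same) with initial? β (proper neg ξ I)
      ... | yes _ = refl
      ... | no ni = cong (proper neg ξ I ∷_) (jump-replace-past X k-neg refl ni same-a same-k same)

      jump-replace-past : ∀ X {k a} → pol k ≡ neg → pol a ≡ neg → ¬ Initial β a →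
                          SameJumps a → SameJumps k → All SameJumps X →
                          jump β a (X ++ k ∷ Q) ≡ jump β a (X ++ k ∷ U)
      jump-replace-past [] {k} {a} k-neg a-neg ni same-a _ _ with justifies? k a
      ... | yes jk = ⊥-elim (neg-not-justifies-neg k-neg a-neg jk)
      ... | no _ = same-a a-neg ni
      jump-replace-past (b ∷ X) {k} {a} k-neg a-neg ni same-a same-k (_ ∷ same) with justifies? b a
      ... | yes _ = cong (b ∷_) (viewR-replace-past X k-neg same-k same)
      ... | no _ = jump-replace-past X k-neg a-neg ni same-a same-k same

module Graft {β : BaseSeqs} (base : Base β) {P M : List Action} {κ⁺ k : Action} {w U : List Action}
  (P≡M∷ʳκ⁺ : P ≡ M ∷ʳ κ⁺) (κ⁺-pos : pol κ⁺ ≡ pos) (κ⁺-proper : IsProper κ⁺) (k-neg : pol k ≡ neg)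
  (path-P : Path β P) (path-US : Path β (reverse U ++ k ∷ w))
  (apart : Disjoint (foci (k ∷ w)) (foci P))
  (U⊆P : U ⊆ P) (U-closed : Views.ViewClosed β (reverse P) U)
  where

  open Views β

  S : List Action
  S = k ∷ w

  P-unique : Unique (foci P)
  P-unique = Path.distinctFoci path-P

  split-US : ∀ x {κ r} → S ≡ x ++ κ ∷ r → reverse U ++ S ≡ (reverse U ++ x) ++ κ ∷ r
  split-US x S≡ = trans (cong (reverse U ++_) S≡) (sym (++-assoc (reverse U) x _))

  same-jumps-via-U : ∀ {a b} → pol a ≡ neg → b ∈ U → Justifies b a → jump β a (reverse P) ≡ jump β a U
  same-jumps-via-U {a} a-neg b∈U jb with jump-some a U b∈U jb
  ... | A , c , B , U≡ , jc , jump-U with U-closed A c B (justifier-of-neg-is-pos a-neg jc) U≡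
  ...   | C , D , rP≡ , B≡ = begin
    jump β a (reverse P)     ≡⟨ cong (jump β a) rP≡ ⟩
    jump β a (C ++ c ∷ D)    ≡⟨ jump-++-∷ a C jc none-in-C ⟩
    c ∷ viewR β D            ≡⟨ cong (c ∷_) (sym (viewR-idem D)) ⟩
    c ∷ viewR β (viewR β D)  ≡⟨ cong (λ V → c ∷ viewR β V) (sym B≡) ⟩
    c ∷ viewR β B            ≡⟨ sym jump-U ⟩
    jump β a U               ∎
    where
    P≡ : P ≡ reverse D ++ c ∷ reverse C
    P≡ = trans (sym (reverse-involutive P)) (trans (cong reverse rP≡) (reverse-++-∷ C c D))

    none-in-C : ∀ {x} → x ∈ C → ¬ Justifies x a
    none-in-C x∈C = cojustifier-not-after (reverse D) (subst (Unique ∘ foci) P≡ P-unique) (Any.reverse⁺ x∈C) jc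

  same-jumps-via-S : ∀ {a b} → b ∈ S → Justifies b a → jump β a (reverse P) ≡ jump β a U
  same-jumps-via-S {a} b∈S jb =
    trans (jump-none a (reverse P) (unjustified ∘ Any.reverse⁻)) (sym (jump-none a U (unjustified ∘ U⊆P)))
    where
    unjustified : ∀ {x} → x ∈ P → ¬ Justifies x a
    unjustified x∈P = cojustifiers-apart apart b∈S x∈P jb

  same-jumps-from : ∀ {a y} → pol a ≡ neg → ¬ Initial β a → y ⊆ S → JustCond β (reverse U ++ y) a →
                    jump β a (reverse P) ≡ jump β a U
  same-jumps-from {✠} ()
  same-jumps-from {proper pos _ _} ()
  same-jumps-from {proper neg _ _} _ ni _ (inj₂ ξ∈Γ) = ⊥-elim (ni (Any.map (λ {s} → ∈Γ⇒∈locs s) ξ∈Γ))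
  same-jumps-from {proper neg _ _} a-neg _ y⊆S (inj₁ justified) with find justified
  ... | b , b∈ , jb with ∈-++⁻ (reverse U) b∈
  ...   | inj₁ b∈U = same-jumps-via-U a-neg (Any.reverse⁻ b∈U) jb
  ...   | inj₂ b∈y = same-jumps-via-S (y⊆S b∈y) jb

  same-jumps : ∀ {a} → a ∈ S → SameJumps (reverse P) U a
  same-jumps a∈S a-neg ni with ∈-∃++ a∈S
  ... | y , z , S≡ = same-jumps-from a-neg ni (prefix-⊆ S≡)
                       (Path.justified path-US (reverse U ++ y) _ z (split-US y S≡))

  view-graft : ∀ x → x ⊆ w → view β (P ++ k ∷ x) ≡ view β (reverse U ++ k ∷ x)
  view-graft x x⊆w = cong reverse (begin
    viewR β (reverse (P ++ k ∷ x))                  ≡⟨ cong (viewR β) (reverse-++-∷ P k x) ⟩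
    viewR β (reverse x ++ k ∷ reverse P)            ≡⟨ viewR-replace-past (reverse P) U (reverse x) k-neg
                                                         (same-jumps (here refl))
                                                         (All.tabulate (same-jumps ∘ there ∘ x⊆w ∘ Any.reverse⁻)) ⟩
    viewR β (reverse x ++ k ∷ U)                    ≡⟨ cong (λ V → viewR β (reverse x ++ k ∷ V)) (sym (reverse-involutive U)) ⟩
    viewR β (reverse x ++ k ∷ reverse (reverse U))  ≡⟨ cong (viewR β) (sym (reverse-++-∷ (reverse U) k x)) ⟩
    viewR β (reverse (reverse U ++ k ∷ x))          ∎)

  locate : ∀ q {κ r} → P ++ S ≡ q ++ κ ∷ r → pol κ ≡ pos →
           (∃[ r' ] P ≡ q ++ κ ∷ r') ⊎ (∃[ x ] (q ≡ P ++ k ∷ x × w ≡ x ++ κ ∷ r))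
  locate q eq κ-pos with ++-∷-cases P S q eq
  ... | inj₁ in-P = inj₁ in-P
  ... | inj₂ ([] , _ , S≡) with refl , _ ← ∷-injective S≡ with trans (sym κ-pos) k-neg
  ...   | ()
  locate q eq κ-pos | inj₂ (_ ∷ x , q≡ , S≡) with refl , w≡ ← ∷-injective S≡ = inj₂ (x , q≡ , w≡)

  justifier-in-U : ∀ {κ' κ y} → pol κ ≡ pos → y ⊆ S → κ' ∈ P → Justifies κ' κ →
                   JustCond β (reverse U ++ y) κ → κ' ∈ reverse U
  justifier-in-U {✠} _ _ _ ()
  justifier-in-U {proper _ _ _} {✠} _ _ _ ()
  justifier-in-U {proper _ _ _} {proper neg _ _} ()
  justifier-in-U {proper _ _ _} {proper pos _ I} _ _ κ'∈P j (inj₂ initial) =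
    ⊥-elim (initial-positive-unjustified {I = I} base (All.lookup (Path.herJust path-P) κ'∈P) j initial)
  justifier-in-U {proper _ _ _} {proper pos _ _} _ y⊆S κ'∈P j (inj₁ justified) with find justified
  ... | b , b∈ , jb with ∈-++⁻ (reverse U) b∈
  ...   | inj₁ b∈U = subst (_∈ reverse U) (cojustifiers-≡ P P-unique (U⊆P (Any.reverse⁻ b∈U)) κ'∈P jb j) b∈U
  ...   | inj₂ b∈y = ⊥-elim (cojustifiers-apart apart (y⊆S b∈y) κ'∈P jb j)

  justifier-moves : ∀ x {κ r κ'} → w ≡ x ++ κ ∷ r → pol κ ≡ pos → Justifies κ' κ →
                    κ' ∈ P ++ k ∷ x → κ' ∈ reverse U ++ k ∷ x
  justifier-moves x {κ} {r} w≡ κ-pos j κ'∈ with ∈-++⁻ P κ'∈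
  ... | inj₂ κ'∈kx = ∈-++⁺ʳ (reverse U) κ'∈kx
  ... | inj₁ κ'∈P = ∈-++⁺ˡ (justifier-in-U κ-pos (prefix-⊆ (cong (k ∷_) w≡)) κ'∈P j
          (Path.justified path-US (reverse U ++ k ∷ x) κ r (split-US (k ∷ x) (cong (k ∷_) w≡))))

  justified : ∀ q κ r → P ++ S ≡ q ++ κ ∷ r → JustCond β q κ
  justified q κ r eq with ++-∷-cases P S q eq
  ... | inj₁ (r' , P≡) = Path.justified path-P q κ r' P≡
  ... | inj₂ (x , refl , S≡) = JustCond-mono κ (Subset.++⁺ˡ x (U⊆P ∘ Any.reverse⁻))
                                 (Path.justified path-US (reverse U ++ x) κ r (split-US x S≡))

  viewCond : ∀ q κ r → P ++ S ≡ q ++ κ ∷ r → pol κ ≡ pos →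
             ∀ κ' → κ' ∈ q → pol κ' ≡ neg → Justifies κ' κ → κ' ∈ view β q
  viewCond q κ r eq κ-pos with locate q eq κ-pos
  ... | inj₁ (r' , P≡) = Path.viewCond path-P q κ r' P≡ κ-pos
  ... | inj₂ (x , refl , w≡) = λ κ' κ'∈ κ'-neg j →
    subst (κ' ∈_) (sym (view-graft x (prefix-⊆ w≡)))
      (Path.viewCond path-US (reverse U ++ k ∷ x) κ r (split-US (k ∷ x) (cong (k ∷_) w≡)) κ-pos
         κ' (justifier-moves x w≡ κ-pos j κ'∈) κ'-neg j)

  initPos : ∀ q ξ I r → P ++ S ≡ q ++ proper pos ξ I ∷ r → ∀ s → s ∈ β → ξ ∈ Δ s →
            (q ≡ [] × Γ s ≡ nothing)
            ⊎ (∃[ q' ] ∃[ ξ' ] ∃[ I' ] (q ≡ q' ∷ʳ proper neg ξ' I' × Any (λ l → Prefix l ξ') (locs s)))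
  initPos q ξ I r eq s s∈ ξ∈ with locate q eq refl
  ... | inj₁ (r' , P≡) = Path.initPos path-P q ξ I r' P≡ s s∈ ξ∈
  ... | inj₂ (x , refl , w≡)
    with Path.initPos path-US (reverse U ++ k ∷ x) ξ I r (split-US (k ∷ x) (cong (k ∷_) w≡)) s s∈ ξ∈
  ...   | inj₁ (empty , _) = ⊥-elim (++-∷≢[] (reverse U) empty)
  ...   | inj₂ (q' , ξ' , I' , q≡ , hj) with ∷ʳ-++⁻ʳ (reverse U) (λ ()) q≡
  ...     | q'' , kx≡ = inj₂ (P ++ q'' , ξ' , I' , trans (cong (P ++_) kx≡) (sym (++-assoc P q'' _)) , hj)

  daimonLast : ∀ q r → P ++ S ≡ q ++ ✠ ∷ r → r ≡ [] × (q ≡ [] → Any (λ s → Γ s ≡ nothing) β)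
  daimonLast q r eq with locate q eq refl
  ... | inj₁ (r' , P≡) with refl , _ ← Path.daimonLast path-P q r' P≡
                       with subst IsProper (∷ʳ-injectiveʳ M q (trans (sym P≡M∷ʳκ⁺) P≡)) κ⁺-proper
  ...   | ()
  daimonLast q r eq | inj₂ (x , refl , w≡) with Path.daimonLast path-US (reverse U ++ k ∷ x) r (split-US (k ∷ x) (cong (k ∷_) w≡))
  ... | r≡[] , _ = r≡[] , λ q≡[] → ⊥-elim (++-∷≢[] P q≡[])

  emptyΓ : ∀ s → s ∈ β → Γ s ≡ nothing →
           ∃[ a ] ∃[ r ] (P ++ S ≡ a ∷ r × (a ≡ ✠ ⊎ ∃[ ξ ] ∃[ I ] (a ≡ proper pos ξ I × ξ ∈ Δ s)))
  emptyΓ s s∈ Γ≡ with Path.emptyΓ path-P s s∈ Γ≡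
  ... | a , r , P≡ , first = a , r ++ S , cong (_++ S) P≡ , first

  path : Path β (P ++ S)
  path = record
    { herJust = All.++⁺ (Path.herJust path-P) (All.++⁻ʳ (reverse U) (Path.herJust path-US))
    ; alternate = subst (λ L → Linked Alternate (L ++ S)) (sym P≡M∷ʳκ⁺)
        (Linked-∷ʳ-++ M (subst (Linked Alternate) P≡M∷ʳκ⁺ (Path.alternate path-P))
          (trans k-neg (cong flip (sym κ⁺-pos))) (Linked-++⁻ʳ (reverse U) (Path.alternate path-US)))
    ; justified = justified
    ; viewCond = viewCond
    ; initPos = initPos
    ; distinctFoci = subst Unique (sym (foci-++ P S))
        (Unique.++⁺ P-unique (Unique-foci-++⁻ʳ (reverse U) (Path.distinctFoci path-US))
          λ (v∈P , v∈S) → apart (v∈S , v∈P))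
    ; daimonLast = daimonLast
    ; emptyΓ = emptyΓ
    }

ViewsAlign : BaseSeqs → List Action → Action → List Action → Action → Set
ViewsAlign β w₁ κ₁ w₂ κ₂ =
  (∃[ u ] ∃[ a ] ∃[ b ] (view β (w₁ ∷ʳ κ₁) ≡ u ∷ʳ a × view β (w₂ ∷ʳ κ₂) ≡ u ∷ʳ b))
  ⊎ (∃[ κ⁺ ] (pol κ⁺ ≡ pos × view β (w₁ ∷ʳ κ₁) ≡ κ⁺ ∷ κ₁ ∷ [] × view β (w₂ ∷ʳ κ₂) ≡ κ₂ ∷ []))

view-fragment : ∀ β w₁ R w₂ {κ₁ κ₂} → pol κ₁ ≡ neg → pol κ₂ ≡ neg → ViewsAlign β w₁ κ₁ w₂ κ₂ →
  ∃[ U ] (view β (w₂ ∷ʳ κ₂) ≡ reverse U ∷ʳ κ₂ × U ⊆ w₁ ++ R × Views.ViewClosed β (reverse (w₁ ++ R)) U)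
view-fragment β _ _ _ _ _ (inj₂ (_ , _ , _ , view₂≡)) = [] , view₂≡ , (λ ()) , Views.ViewClosed-[] β
view-fragment β w₁ R w₂ {κ₂ = κ₂} κ₁-neg κ₂-neg (inj₁ (u , _ , b , view₁≡ , view₂≡))
  with Views.view-∷ʳ-neg β w₁ κ₁-neg | Views.view-∷ʳ-neg β w₂ κ₂-neg
... | T , view₁≡T , T⊆ , T-closed | _ , view₂≡T₂ , _ , _ =
  T , trans view₂≡ (cong₂ _∷ʳ_ u≡ b≡) , ∈-++⁺ˡ ∘ Any.reverse⁻ {xs = w₁} ∘ T⊆ ,
  subst (λ L → Views.ViewClosed β L T) (sym (reverse-++ w₁ R)) (Views.ViewClosed-++ β (reverse R) T-closed)
  where
  u≡ : u ≡ reverse T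
  u≡ = ∷ʳ-injectiveˡ u (reverse T) (trans (sym view₁≡) view₁≡T)

  b≡ : b ≡ κ₂
  b≡ = ∷ʳ-injectiveʳ u _ (trans (sym view₂≡) view₂≡T₂)

proposition3p8 : (β : BaseSeqs) → Base β →
    (w₁ : List Action) (κ₁⁻ : Action) (w₁' : List Action) (κ₁⁺ : Action)
    (w₂ : List Action) (κ₂⁻ : Action) (w₂' : List Action) →
    pol κ₁⁻ ≡ neg → pol κ₂⁻ ≡ neg → pol κ₁⁺ ≡ pos →
    Path β (w₁ ++ κ₁⁻ ∷ w₁' ++ κ₁⁺ ∷ []) →
    Path β (w₂ ++ κ₂⁻ ∷ w₂') →
    IsProper κ₁⁺ →
    Path β (view β (w₂ ∷ʳ κ₂⁻) ++ w₂') →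
    Disjoint (foci (κ₂⁻ ∷ w₂')) (foci (w₁ ++ κ₁⁻ ∷ w₁' ++ κ₁⁺ ∷ [])) →
    ((Initial β κ₁⁻ × Initial β κ₂⁻)
     ⊎ (∃[ κ⁺ ] (pol κ⁺ ≡ pos × κ⁺ ∈ w₁ × κ⁺ ∈ w₂
                 × Justifies κ⁺ κ₁⁻ × Justifies κ⁺ κ₂⁻))
     ⊎ (∃[ κ⁺ ] (pol κ⁺ ≡ pos × w₁ ≡ κ⁺ ∷ [] × w₂ ≡ κ⁺ ∷ []
                 × Justifies κ⁺ κ₁⁻ × Initial β κ₂⁻))) →
    ((∃[ u ] ∃[ a ] ∃[ b ] (view β (w₁ ∷ʳ κ₁⁻) ≡ u ∷ʳ a
                           × view β (w₂ ∷ʳ κ₂⁻) ≡ u ∷ʳ b))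
     ⊎ (∃[ κ⁺ ] (pol κ⁺ ≡ pos × view β (w₁ ∷ʳ κ₁⁻) ≡ κ⁺ ∷ κ₁⁻ ∷ []
                 × view β (w₂ ∷ʳ κ₂⁻) ≡ κ₂⁻ ∷ []))) →
    Path β (w₁ ++ κ₁⁻ ∷ w₁' ++ κ₁⁺ ∷ κ₂⁻ ∷ w₂')
proposition3p8 β base w₁ κ₁⁻ w₁' κ₁⁺ w₂ κ₂⁻ w₂' κ₁⁻-neg κ₂⁻-neg κ₁⁺-pos path₁ _ κ₁⁺-proper path-view apart _ views
  with view-fragment β w₁ (κ₁⁻ ∷ w₁' ++ κ₁⁺ ∷ []) w₂ κ₁⁻-neg κ₂⁻-neg views
... | U , view≡ , U⊆ , U-closed =
  subst (Path β) reassociate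
    (Graft.path base (sym (++-assoc w₁ (κ₁⁻ ∷ w₁') [ κ₁⁺ ])) κ₁⁺-pos κ₁⁺-proper κ₂⁻-neg path₁
      (subst (Path β) (trans (cong (_++ w₂') view≡) (++-assoc (reverse U) [ κ₂⁻ ] w₂')) path-view)
      apart U⊆ U-closed)
  where
  reassociate : (w₁ ++ κ₁⁻ ∷ w₁' ++ κ₁⁺ ∷ []) ++ κ₂⁻ ∷ w₂' ≡ w₁ ++ κ₁⁻ ∷ w₁' ++ κ₁⁺ ∷ κ₂⁻ ∷ w₂'
  reassociate = trans (++-assoc w₁ _ _) (cong (λ v → w₁ ++ κ₁⁻ ∷ v) (++-assoc w₁' [ κ₁⁺ ] _))
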